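{- Let $\mathbf{Con}_{\mathbf{LF}}\subseteq\mathbf{LF}$ and $\mathbf{Con}_{\mathbf{AF}}\subseteq\mathbf{AF}$ be the sets of connected quivers. Then $\mathbf{Con}_{\mathbf{LF}}$ is not dense, has empty interior, and is $\mathbf\Pi^0_2$ in $\mathbf{LF}$; and $\mathbf{Con}_{\mathbf{AF}}$ is dense, has empty interior, and is $\mathbf\Pi^0_2$ in $\mathbf{AF}$.
   Context: $\mathbb{N}$ is the positive integers. A quiver on $\mathbb{N}$ is a function $Q:\mathbb{N}\times\mathbb{N}\to\mathbb{Z}$ with $Q(x,y)=-Q(y,x)$; it is locally finite if $\sum_y|Q(x,y)|<\infty$ for each $x$. $\mathbf{AF}$ is the set of all quivers on $\mathbb{N}$ with the topology generated by $U_{Q,V}=\{Q':Q'(x,y)=Q(x,y)\ \forall x,y\in V\}$, $V$ finite. $\mathbf{LF}$ is the set of locally finite quivers with the topology generated by $\{Q'\in\mathbf{LF}:Q'(x,y)=Q(x,y)\text{ whenever }x\in V\text{ or }y\in V\}$, $V$ finite. A quiver is connected if its underlying undirected graph (with an edge $\{x,y\}$ whenever $Q(x,y)\neq0$) has at most one connected component that is not an isolated vertex. $\mathbf\Pi^0_2$ means $G_\delta$. -}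

module Defs where

open import Data.Nat using (ℕ; _≤_)
open import Data.Integer using (ℤ; -_; 0ℤ)
open import Data.List using (List)
open import Data.List.Membership.Propositional using (_∈_)
open import Data.Product using (Σ; ∃; _×_; _,_; proj₁)
open import Data.Sum using (_⊎_)
open import Relation.Nullary using (¬_)
open import Relation.Binary.PropositionalEquality using (_≡_; _≢_)
open import Level using (Level)

-- Quivers on the vertex set ℕ (ℕ = {0,1,2,...} plays the role of the
-- paper's positive integers; this is just a relabelling x ↦ x+1).

record Quiver : Set where
  field
    Q    : ℕ → ℕ → ℤ
    anti : ∀ x y → Q x y ≡ - Q y x
open Quiver public

-- Locally finite: ∑_y |Q(x,y)| < ∞.  Since the entries are integers,
-- this sum is finite iff only finitely many entries Q(x,y) are nonzero,
-- i.e. iff there is a bound N with Q(x,y) = 0 for all y ≥ N.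
LocallyFinite : Quiver → Set
LocallyFinite q = ∀ x → ∃ λ N → ∀ y → N ≤ y → Q q x y ≡ 0ℤ

LFQuiver : Set
LFQuiver = Σ Quiver LocallyFinite

NbhdAF : List ℕ → Quiver → Quiver → Set
NbhdAF V q q' = ∀ x y → x ∈ V → y ∈ V → Q q' x y ≡ Q q x y

NbhdLF : List ℕ → LFQuiver → LFQuiver → Set
NbhdLF V q q' = ∀ x y → (x ∈ V ⊎ y ∈ V) → Q (proj₁ q') x y ≡ Q (proj₁ q) x y

-- Topology generated by a family of basic neighbourhoods
-- Nbhd V x  (a basic open set containing x, for each finite V).
-- (In both cases the family is a basis: y ∈ Nbhd V x implies
--  Nbhd V y = Nbhd V x.)

module Topology {X : Set} (Nbhd : List ℕ → X → X → Set) where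

  IsOpen : (X → Set) → Set
  IsOpen U = ∀ x → U x → ∃ λ V → ∀ y → Nbhd V x y → U y

  Dense : (X → Set) → Set₁
  Dense S = ∀ (U : X → Set) → IsOpen U → (∃ λ x → U x) → ∃ λ x → U x × S x

  EmptyInterior : (X → Set) → Set₁
  EmptyInterior S = ∀ (U : X → Set) → IsOpen U → (∀ x → U x → S x) → ∀ x → ¬ U x

  -- Π⁰₂ = G_δ: a countable intersection of open sets
  IsGδ : (X → Set) → Set₁
  IsGδ S = Σ (ℕ → X → Set) λ U →
             (∀ n → IsOpen (U n)) × (∀ x → (S x → ∀ n → U n x) × ((∀ n → U n x) → S x))

-- the underlying undirected graph has an edge {x,y} iff Q(x,y) ≠ 0
-- (symmetric by antisymmetry of Q)
data Reach (q : Quiver) : ℕ → ℕ → Set where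
  here : ∀ {x} → Reach q x x
  step : ∀ {x y z} → Q q x y ≢ 0ℤ → Reach q y z → Reach q x z

NonIsolated : Quiver → ℕ → Set
NonIsolated q x = ∃ λ y → Q q x y ≢ 0ℤ

-- at most one connected component that is not an isolated vertex:
-- any two non-isolated vertices lie in the same component
Connected : Quiver → Set
Connected q = ∀ x y → NonIsolated q x → NonIsolated q y → Reach q x y

ConAF : Quiver → Set
ConAF = Connected

ConLF : LFQuiver → Set
ConLF q = Connected (proj₁ q)

module AF = Topology NbhdAF
module LF = Topology NbhdLF

-- Outside a finite square [0,K)² any quiver can be overwritten at will. Overwriting it by two
-- disjoint edges beyond K disconnects the quiver, overwriting it by a star centred at K
-- connects it. An AF-neighbourhood only sees a finite square, whence density and empty interior
-- in AF. An LF-neighbourhood sees finitely many whole rows, which local finiteness confines to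
-- some square, so grafting two disjoint edges still shows the empty interior; but fixing the rows
-- 1, 2, 3 of the quiver with edges 1 → 2 and 3 → 4 leaves {1, 2} a component, so no
-- connected quiver is near it. Finally, connectedness is the intersection over all (a, b, c, d)
-- of "Q(a,c) ≠ 0 → Q(b,d) ≠ 0 → a reaches b", and each of these conditions is open in AF
-- (hence in LF) because a path only involves finitely many entries.
module Submission where

open import Defs
open import Data.Product using (_×_)
open import Relation.Nullary using (¬_)

open import Data.Bool using (if_then_else_)
open import Data.Integer using (ℤ; 0ℤ; 1ℤ; -_; _-_)
import Data.Integer.Properties as ℤ
open import Algebra.Properties.AbelianGroup ℤ.+-0-abelianGroup using (⁻¹-anti-homo‿-)
open import Data.List using (List; []; _∷_; map)
open import Data.List.Extrema.Nat using (max; xs≤max)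
open import Data.List.Membership.Propositional using (_∈_)
open import Data.List.Membership.Propositional.Properties using (∈-map⁺)
import Data.List.Relation.Unary.All as All
open import Data.List.Relation.Unary.Any using (here; there)
open import Data.Nat using (ℕ; zero; suc; _+_; _∸_; _⊔_; _≤_; _<_; s≤s; _<?_; _≟_)
open import Data.Nat.Properties
  using (≤-refl; ≤-trans; <⇒≤; <⇒≱; ≮⇒≥; m≤m⊔n; m≤n⊔m; m≤n+m; +-suc; +-identityʳ;
         suc-injective; m≤n⇒m∸n≡0; m∸n≢0⇒n<m; m+n∸n≡m; ∸-monoˡ-≤)
open import Data.Product using (∃; _,_; proj₁; proj₂)
import Data.Product as Product
open import Data.Sum using (_⊎_; inj₁; inj₂)
open import Function using (_∘_; case_of_)
open import Relation.Nullary using (yes; no; does; contradiction)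
open import Relation.Nullary.Decidable using (dec-true; dec-false)
open import Relation.Binary.PropositionalEquality
  using (_≡_; _≢_; refl; sym; trans; cong; cong₂; subst; module ≡-Reasoning)
open ≡-Reasoning

≡1⇒≢0 : ∀ {z : ℤ} → z ≡ 1ℤ → z ≢ 0ℤ
≡1⇒≢0 refl ()

maxOver : (ℕ → ℕ) → List ℕ → ℕ
maxOver f V = max 0 (map f V)

≤-maxOver : ∀ f {a V} → a ∈ V → f a ≤ maxOver f V
≤-maxOver f {V = V} a∈V = All.lookup (xs≤max 0 (map f V)) (∈-map⁺ f a∈V)

antisymmetrisation : (ℕ → ℕ → ℤ) → Quiver
antisymmetrisation h = record
  { Q    = λ a b → h a b - h b a
  ; anti = λ a b → sym (⁻¹-anti-homo‿- (h b a) (h a b))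
  }

pullback : (ℕ → ℕ) → Quiver → Quiver
pullback f q = record { Q = λ a b → Q q (f a) (f b) ; anti = λ a b → anti q (f a) (f b) }

transpose-agree : ∀ x y {a b} → Q y b a ≡ Q x b a → Q y a b ≡ Q x a b
transpose-agree x y {a} {b} eq = begin
  Q y a b    ≡⟨ anti y a b ⟩
  - Q y b a  ≡⟨ cong -_ eq ⟩
  - Q x b a  ≡⟨ sym (anti x a b) ⟩
  Q x a b    ∎

squarePatchQ : ℕ → Quiver → Quiver → ℕ → ℕ → ℤ
squarePatchQ K x q a b with a <? K | b <? K
... | yes _ | yes _ = Q x a b
... | _     | _     = Q q a b

squarePatch-anti : ∀ K x q a b → squarePatchQ K x q a b ≡ - squarePatchQ K x q b a
squarePatch-anti K x q a b with a <? K | b <? K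
... | yes _ | yes _ = anti x a b
... | yes _ | no  _ = anti q a b
... | no  _ | yes _ = anti q a b
... | no  _ | no  _ = anti q a b

squarePatch : ℕ → Quiver → Quiver → Quiver
squarePatch K x q = record { Q = squarePatchQ K x q ; anti = squarePatch-anti K x q }

squarePatch-inside : ∀ {K x q a b} → a < K → b < K → Q (squarePatch K x q) a b ≡ Q x a b
squarePatch-inside {K} {a = a} {b} a<K b<K with a <? K | b <? K
... | yes _  | yes _  = refl
... | no a≮K | _      = contradiction a<K a≮K
... | yes _  | no b≮K = contradiction b<K b≮K

squarePatch-outside : ∀ {K x q a b} → K ≤ a ⊎ K ≤ b → Q (squarePatch K x q) a b ≡ Q q a b
squarePatch-outside {K} {a = a} {b} outside with a <? K | b <? K | outside
... | yes a<K | yes _   | inj₁ K≤a = contradiction K≤a (<⇒≱ a<K)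
... | yes _   | yes b<K | inj₂ K≤b = contradiction K≤b (<⇒≱ b<K)
... | yes _   | no _    | _        = refl
... | no _    | _       | _        = refl

squarePatch-NbhdAF : ∀ {V} K x q → (∀ {a} → a ∈ V → a < K) → NbhdAF V x (squarePatch K x q)
squarePatch-NbhdAF K x q V<K a b a∈V b∈V = squarePatch-inside (V<K a∈V) (V<K b∈V)

Reach-trans : ∀ {q a b c} → Reach q a b → Reach q b c → Reach q a c
Reach-trans here         r′ = r′
Reach-trans (step ab≢0 r) r′ = step ab≢0 (Reach-trans r r′)

Reach-closed : ∀ {q} (P : ℕ → Set) → (∀ {z w} → P z → Q q z w ≢ 0ℤ → P w) →
               ∀ {a b} → Reach q a b → P a → P b
Reach-closed P closed here          Pa = Pa
Reach-closed P closed (step ab≢0 r) Pa = Reach-closed P closed r (closed Pa ab≢0)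

closedSet⇒¬Connected : ∀ {q} (P : ℕ → Set) → (∀ {z w} → P z → Q q z w ≢ 0ℤ → P w) →
                       ∀ {a b} → P a → ¬ P b → NonIsolated q a → NonIsolated q b → ¬ Connected q
closedSet⇒¬Connected P closed Pa ¬Pb na nb connected =
  ¬Pb (Reach-closed P closed (connected _ _ na nb) Pa)

hub⇒Connected : ∀ {q} c → (∀ a → a ≢ c → Q q a c ≢ 0ℤ) → Connected q
hub⇒Connected {q} c adjacent a b _ _ = Reach-trans (toHub a) (fromHub b)
  where
  toHub : ∀ a → Reach q a c
  toHub a with a ≟ c
  ... | yes refl = here
  ... | no a≢c   = step (adjacent a a≢c) here
  fromHub : ∀ b → Reach q c b
  fromHub b with b ≟ c
  ... | yes refl = here
  ... | no b≢c   = step (λ cb≡0 → adjacent b b≢c (trans (anti q b c) (cong -_ cb≡0))) here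

arrows₀ : ℕ → ℕ → ℤ
arrows₀ 1 2 = 1ℤ
arrows₀ 3 4 = 1ℤ
arrows₀ _ _ = 0ℤ

twoEdges₀ : Quiver
twoEdges₀ = antisymmetrisation arrows₀

twoEdges₀-closed : ∀ {c d} → c ∈ 1 ∷ 2 ∷ [] → Q twoEdges₀ c d ≢ 0ℤ → d ∈ 1 ∷ 2 ∷ []
twoEdges₀-closed {d = 1} _ _ = here refl
twoEdges₀-closed {d = 2} _ _ = there (here refl)
twoEdges₀-closed {d = 0}                             (here refl)         cd≢0 = contradiction refl cd≢0
twoEdges₀-closed {d = 3}                             (here refl)         cd≢0 = contradiction refl cd≢0
twoEdges₀-closed {d = 4}                             (here refl)         cd≢0 = contradiction refl cd≢0
twoEdges₀-closed {d = suc (suc (suc (suc (suc _))))} (here refl)         cd≢0 = contradiction refl cd≢0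
twoEdges₀-closed {d = 0}                             (there (here refl)) cd≢0 = contradiction refl cd≢0
twoEdges₀-closed {d = 3}                             (there (here refl)) cd≢0 = contradiction refl cd≢0
twoEdges₀-closed {d = 4}                             (there (here refl)) cd≢0 = contradiction refl cd≢0
twoEdges₀-closed {d = suc (suc (suc (suc (suc _))))} (there (here refl)) cd≢0 = contradiction refl cd≢0

twoEdges₀-isolated₀ : ∀ d → Q twoEdges₀ 0 d ≡ 0ℤ
twoEdges₀-isolated₀ 0                         = refl
twoEdges₀-isolated₀ 1                         = refl
twoEdges₀-isolated₀ 2                         = refl
twoEdges₀-isolated₀ 3                         = refl
twoEdges₀-isolated₀ (suc (suc (suc (suc _)))) = refl

twoEdges₀-vanishes-col≥5 : ∀ c {d} → 5 ≤ d → Q twoEdges₀ c d ≡ 0ℤ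
twoEdges₀-vanishes-col≥5 0                         (s≤s (s≤s (s≤s (s≤s (s≤s _))))) = refl
twoEdges₀-vanishes-col≥5 1                         (s≤s (s≤s (s≤s (s≤s (s≤s _))))) = refl
twoEdges₀-vanishes-col≥5 2                         (s≤s (s≤s (s≤s (s≤s (s≤s _))))) = refl
twoEdges₀-vanishes-col≥5 3                         (s≤s (s≤s (s≤s (s≤s (s≤s _))))) = refl
twoEdges₀-vanishes-col≥5 (suc (suc (suc (suc _)))) (s≤s (s≤s (s≤s (s≤s (s≤s _))))) = refl

-- Truncated subtraction sends every vertex ≤ K to the isolated vertex 0 of twoEdges₀, so the
-- only edges of twoEdges K are K+1 → K+2 and K+3 → K+4.
twoEdges : ℕ → Quiver
twoEdges K = pullback (_∸ K) twoEdges₀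

twoEdges-shifted : ∀ K i j → Q (twoEdges K) (i + K) (j + K) ≡ Q twoEdges₀ i j
twoEdges-shifted K i j rewrite m+n∸n≡m i K | m+n∸n≡m j K = refl

twoEdges-vanishes-row≤ : ∀ {K a} b → a ≤ K → Q (twoEdges K) a b ≡ 0ℤ
twoEdges-vanishes-row≤ {K} b a≤K rewrite m≤n⇒m∸n≡0 a≤K = twoEdges₀-isolated₀ (b ∸ K)

twoEdges-vanishes-col≥ : ∀ {K} a {b} → 5 + K ≤ b → Q (twoEdges K) a b ≡ 0ℤ
twoEdges-vanishes-col≥ {K} a {b} 5+K≤b =
  twoEdges₀-vanishes-col≥5 (a ∸ K) (subst (_≤ b ∸ K) (m+n∸n≡m 5 K) (∸-monoˡ-≤ K 5+K≤b))

twoEdges-locallyFinite : ∀ K → LocallyFinite (twoEdges K)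
twoEdges-locallyFinite K a = 5 + K , λ b → twoEdges-vanishes-col≥ a

agreesWithTwoEdges⇒¬Connected :
  ∀ K {y} → (∀ {z} w → z ∸ K ∈ 1 ∷ 2 ∷ 3 ∷ [] → Q y z w ≡ Q (twoEdges K) z w) → ¬ Connected y
agreesWithTwoEdges⇒¬Connected K {y} agree =
  closedSet⇒¬Connected P closed (here (m+n∸n≡m 1 K)) ¬P[3+K]
    (edge 1 (here (m+n∸n≡m 1 K)) refl) (edge 3 (there (there (here (m+n∸n≡m 3 K)))) refl)
  where
  P : ℕ → Set
  P z = z ∸ K ∈ 1 ∷ 2 ∷ []
  row : ∀ {z} → P z → z ∸ K ∈ 1 ∷ 2 ∷ 3 ∷ []
  row (here p)         = here p
  row (there (here p)) = there (here p)
  closed : ∀ {z w} → P z → Q y z w ≢ 0ℤ → P w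
  closed Pz zw≢0 = twoEdges₀-closed Pz (λ zw≡0 → zw≢0 (trans (agree _ (row Pz)) zw≡0))
  ¬P[3+K] : ¬ ((3 + K) ∸ K ∈ 1 ∷ 2 ∷ [])
  ¬P[3+K] rewrite m+n∸n≡m 3 K = λ { (here ()) ; (there (here ())) }
  edge : ∀ i → (i + K) ∸ K ∈ 1 ∷ 2 ∷ 3 ∷ [] → Q twoEdges₀ i (suc i) ≡ 1ℤ → NonIsolated y (i + K)
  edge i i∈rows i→suc-i = suc i + K , ≡1⇒≢0 (begin
    Q y (i + K) (suc i + K)              ≡⟨ agree _ i∈rows ⟩
    Q (twoEdges K) (i + K) (suc i + K)   ≡⟨ twoEdges-shifted K i (suc i) ⟩
    Q twoEdges₀ i (suc i)                ≡⟨ i→suc-i ⟩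
    1ℤ                                   ∎)

graft : ℕ → Quiver → Quiver
graft K x = squarePatch K x (twoEdges K)

graft-¬Connected : ∀ K x → ¬ Connected (graft K x)
graft-¬Connected K x = agreesWithTwoEdges⇒¬Connected K λ w z∈rows → squarePatch-outside (inj₁ (K≤ z∈rows))
  where
  K≤ : ∀ {z} → z ∸ K ∈ 1 ∷ 2 ∷ 3 ∷ [] → K ≤ z
  K≤ z∈rows = <⇒≤ (m∸n≢0⇒n<m λ z∸K≡0 → 0∉rows (subst (_∈ 1 ∷ 2 ∷ 3 ∷ []) z∸K≡0 z∈rows))
    where
    0∉rows : ¬ (0 ∈ 1 ∷ 2 ∷ 3 ∷ [])
    0∉rows (there (there (here ())))

graft-locallyFinite : ∀ K x → LocallyFinite (graft K x)
graft-locallyFinite K x a = 5 + K , λ b 5+K≤b →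
  trans (squarePatch-outside (inj₂ (≤-trans (m≤n+m K 5) 5+K≤b))) (twoEdges-vanishes-col≥ a 5+K≤b)

graft-NbhdLF : ∀ {K V} x (lf : LocallyFinite x) → (∀ {a} → a ∈ V → a < K) →
               (∀ {a} → a ∈ V → ∀ b → K ≤ b → Q x a b ≡ 0ℤ) →
               NbhdLF V (x , lf) (graft K x , graft-locallyFinite K x)
graft-NbhdLF {K} x lf V<K V-supported a b (inj₁ a∈V) = case b <? K of λ where
  (yes b<K) → squarePatch-inside (V<K a∈V) b<K
  (no b≮K)  → begin
    Q (graft K x) a b    ≡⟨ squarePatch-outside (inj₂ (≮⇒≥ b≮K)) ⟩
    Q (twoEdges K) a b   ≡⟨ twoEdges-vanishes-row≤ b (<⇒≤ (V<K a∈V)) ⟩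
    0ℤ                   ≡⟨ sym (V-supported a∈V b (≮⇒≥ b≮K)) ⟩
    Q x a b              ∎
graft-NbhdLF {K} x lf V<K V-supported a b (inj₂ b∈V) =
  transpose-agree x (graft K x) (graft-NbhdLF x lf V<K V-supported b a (inj₁ b∈V))

star : ℕ → Quiver
star c = antisymmetrisation (λ _ b → if does (b ≟ c) then 1ℤ else 0ℤ)

star-toCentre : ∀ {c a} → a ≢ c → Q (star c) a c ≡ 1ℤ
star-toCentre {c} {a} a≢c rewrite dec-true (c ≟ c) refl | dec-false (a ≟ c) a≢c = refl

starPatch-Connected : ∀ K x → Connected (squarePatch K x (star K))
starPatch-Connected K x = hub⇒Connected K λ a a≢K →
  ≡1⇒≢0 (trans (squarePatch-outside {K} {x} {star K} (inj₂ ≤-refl)) (star-toCentre a≢K))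

module Basis {X : Set} (Nbhd : List ℕ → X → X → Set) where
  open Topology Nbhd

  meetsEveryNbhd⇒Dense : ∀ {S} → (∀ V x → ∃ λ y → Nbhd V x y × S y) → Dense S
  meetsEveryNbhd⇒Dense meets U U-open (x , Ux) =
    let V , V⊆U      = U-open x Ux
        y , xVy , Sy = meets V x
    in y , V⊆U y xVy , Sy

  avoidsEveryNbhd⇒EmptyInterior : ∀ {S} → (∀ V x → ∃ λ y → Nbhd V x y × ¬ S y) → EmptyInterior S
  avoidsEveryNbhd⇒EmptyInterior avoids U U-open U⊆S x Ux =
    let V , V⊆U       = U-open x Ux
        y , xVy , ¬Sy = avoids V x
    in ¬Sy (U⊆S y (V⊆U y xVy))

ConAF-dense : AF.Dense ConAF
ConAF-dense = Basis.meetsEveryNbhd⇒Dense NbhdAF λ V x →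
  let K = maxOver suc V
  in squarePatch K x (star K) , squarePatch-NbhdAF K x (star K) (≤-maxOver suc) , starPatch-Connected K x

ConAF-emptyInterior : AF.EmptyInterior ConAF
ConAF-emptyInterior = Basis.avoidsEveryNbhd⇒EmptyInterior NbhdAF λ V x →
  let K = maxOver suc V
  in graft K x , squarePatch-NbhdAF K x (twoEdges K) (≤-maxOver suc) , graft-¬Connected K x

ConLF-emptyInterior : LF.EmptyInterior ConLF
ConLF-emptyInterior = Basis.avoidsEveryNbhd⇒EmptyInterior NbhdLF avoids
  where
  avoids : ∀ V q → ∃ λ y → NbhdLF V q y × ¬ ConLF y
  avoids V (x , lf) =
    (graft K x , graft-locallyFinite K x) , graft-NbhdLF x lf V<K V-supported , graft-¬Connected K x
    where
    bound : ℕ → ℕ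
    bound a = suc a ⊔ proj₁ (lf a)
    K : ℕ
    K = maxOver bound V
    V<K : ∀ {a} → a ∈ V → a < K
    V<K {a} a∈V = ≤-trans (m≤m⊔n (suc a) (proj₁ (lf a))) (≤-maxOver bound a∈V)
    V-supported : ∀ {a} → a ∈ V → ∀ b → K ≤ b → Q x a b ≡ 0ℤ
    V-supported {a} a∈V b K≤b =
      proj₂ (lf a) b (≤-trans (m≤n⊔m (suc a) (proj₁ (lf a))) (≤-trans (≤-maxOver bound a∈V) K≤b))

NbhdLF-isOpen : ∀ V q → LF.IsOpen (NbhdLF V q)
NbhdLF-isOpen V q y qVy = V , λ z yVz u v uv∈V → trans (yVz u v uv∈V) (qVy u v uv∈V)

ConLF-¬Dense : ¬ LF.Dense ConLF
ConLF-¬Dense dense =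
  let y , nearTwoEdges , connected = dense (NbhdLF rows twoEdgesᴸᶠ) (NbhdLF-isOpen rows twoEdgesᴸᶠ)
                                           (twoEdgesᴸᶠ , λ _ _ _ → refl)
  in agreesWithTwoEdges⇒¬Connected 0 (λ w z∈rows → nearTwoEdges _ w (inj₁ z∈rows)) connected
  where
  rows : List ℕ
  rows = 1 ∷ 2 ∷ 3 ∷ []
  twoEdgesᴸᶠ : LFQuiver
  twoEdgesᴸᶠ = twoEdges 0 , twoEdges-locallyFinite 0

vertices : ∀ {q a b} → Reach q a b → List ℕ
vertices (here {a})     = a ∷ []
vertices (step {a} _ r) = a ∷ vertices r

source∈vertices : ∀ {q a b} (r : Reach q a b) → a ∈ vertices r
source∈vertices here       = here refl
source∈vertices (step _ r) = here refl

Reach-transport : ∀ {x y a b} (r : Reach x a b) → NbhdAF (vertices r) x y → Reach y a b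
Reach-transport here                     _   = here
Reach-transport {a = a} (step {y = w} aw≢0 r) xVy =
  step (λ aw≡0 → aw≢0 (trans (sym (xVy a w (here refl) (there (source∈vertices r)))) aw≡0))
       (Reach-transport r (λ u v u∈r v∈r → xVy u v (there u∈r) (there v∈r)))

Linked : (ℕ × ℕ) × (ℕ × ℕ) → Quiver → Set
Linked ((a , b) , (c , d)) q = Q q a c ≢ 0ℤ → Q q b d ≢ 0ℤ → Reach q a b

Linked-isOpen : ∀ t → AF.IsOpen (Linked t)
Linked-isOpen ((a , b) , (c , d)) x linked with Q x a c ℤ.≟ 0ℤ | Q x b d ℤ.≟ 0ℤ
... | yes ac≡0 | _ = (a ∷ c ∷ []) , λ y xVy ac≢0 _ →
  contradiction (trans (xVy a c (here refl) (there (here refl))) ac≡0) ac≢0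
... | no _ | yes bd≡0 = (b ∷ d ∷ []) , λ y xVy _ bd≢0 →
  contradiction (trans (xVy b d (here refl) (there (here refl))) bd≡0) bd≢0
... | no ac≢0 | no bd≢0 = vertices r , λ y xVy _ _ → Reach-transport r xVy
  where r = linked ac≢0 bd≢0

diagonalStep : ℕ × ℕ → ℕ × ℕ
diagonalStep (zero  , b) = suc b , 0
diagonalStep (suc a , b) = a , suc b

unpair : ℕ → ℕ × ℕ
unpair zero    = 0 , 0
unpair (suc n) = diagonalStep (unpair n)

-- s indexes the diagonal of (a , b); the recursion is lexicographic in (s , b).
unpair-hits : ∀ s b a → a + b ≡ s → ∃ λ n → unpair n ≡ (a , b)
unpair-hits s       zero    zero    _     = 0 , refl
unpair-hits s       (suc b) a       a+b≡s =
  let n , n↦ = unpair-hits s b (suc a) (trans (sym (+-suc a b)) a+b≡s)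
  in suc n , cong diagonalStep n↦
unpair-hits (suc s) zero    (suc a) a+0≡s =
  let n , n↦ = unpair-hits s a zero (trans (sym (+-identityʳ a)) (suc-injective a+0≡s))
  in suc n , cong diagonalStep n↦
unpair-hits zero    zero    (suc a) ()

unpair-surjective : ∀ p → ∃ λ n → unpair n ≡ p
unpair-surjective (a , b) = unpair-hits (a + b) b a refl

unpair² : ℕ → (ℕ × ℕ) × (ℕ × ℕ)
unpair² = Product.map unpair unpair ∘ unpair

unpair²-surjective : ∀ t → ∃ λ n → unpair² n ≡ t
unpair²-surjective (p , p′) =
  let i , i↦p   = unpair-surjective p
      j , j↦p′  = unpair-surjective p′
      n , n↦ij  = unpair-surjective (i , j)
  in n , trans (cong (Product.map unpair unpair) n↦ij) (cong₂ _,_ i↦p j↦p′)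

Connected-isGδ : AF.IsGδ Connected
Connected-isGδ = Linked ∘ unpair² , Linked-isOpen ∘ unpair² , λ q → linked q , connected q
  where
  linked : ∀ q → Connected q → ∀ n → Linked (unpair² n) q
  linked q con n ac≢0 bd≢0 = con _ _ (_ , ac≢0) (_ , bd≢0)
  connected : ∀ q → (∀ n → Linked (unpair² n) q) → Connected q
  connected q allLinked a b (c , ac≢0) (d , bd≢0) =
    let n , n↦abcd = unpair²-surjective ((a , b) , (c , d))
    in subst (λ t → Linked t q) n↦abcd (allLinked n) ac≢0 bd≢0

AF-open⇒LF-open : ∀ {U} → AF.IsOpen U → LF.IsOpen (U ∘ proj₁)
AF-open⇒LF-open U-open (x , _) Ux =
  let V , V⊆U = U-open x Ux in V , λ y xVy → V⊆U (proj₁ y) (λ u v u∈V _ → xVy u v (inj₁ u∈V))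

AF-Gδ⇒LF-Gδ : ∀ {S} → AF.IsGδ S → LF.IsGδ (S ∘ proj₁)
AF-Gδ⇒LF-Gδ (U , U-open , S⇔⋂U) = (λ n → U n ∘ proj₁) , AF-open⇒LF-open ∘ U-open , S⇔⋂U ∘ proj₁

proposition4p17 : (¬ LF.Dense ConLF × LF.EmptyInterior ConLF × LF.IsGδ ConLF)
                  × (AF.Dense ConAF × AF.EmptyInterior ConAF × AF.IsGδ ConAF)
proposition4p17 = (ConLF-¬Dense , ConLF-emptyInterior , AF-Gδ⇒LF-Gδ Connected-isGδ)
                , (ConAF-dense , ConAF-emptyInterior , Connected-isGδ)
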